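{- Let $\hat{C}=(\hat{V},\hat{N},\hat{P})$ be an abstract component with layout $\mathit{C}$. Then the algorithm Abstract-C, run on $\hat{C}$, always terminates (for every choice of the nodes and edges selected in its loops).
   Context: An abstract component with layout $\mathit{C}$ (cycle) is a directed graph $(\hat{V},\hat{N},\hat{P})$ with $\hat{V}$ a finite set of variables, $\hat{N}$ a finite set of nodes and $\hat{P}\subseteq(\hat{V}\times\hat{N})\cup(\hat{N}\times\hat{N})$. For $n\in\hat{N}$ let $P_{in}(\{n\})=\{(x,n)\in\hat{P}\mid x\in\hat{N}\setminus\{n\}\}$ and $P_{out}(\{n\})=\{(n,x)\in\hat{P}\mid x\in\hat{N}\setminus\{n\}\}$. A node $n$ is special if $(v,n)\in\hat{P}$ for some $v\in\hat{V}$, or $|P_{in}(\{n\})|>1$, or $|P_{out}(\{n\})|>1$; otherwise it is ordinary. Algorithm Abstract-C: (1) $M\leftarrow$ the set of ordinary nodes of $\hat{N}$; (2) while there are $a,b\in M$ with $a\neq b$ and $(a,b)\in\hat{P}$: (i) while there exists $(b,c)\in\hat{P}$: $\hat{P}\leftarrow(\hat{P}\setminus\{(b,c)\})\cup\{(a,c)\}$; (ii) $\hat{N}\leftarrow\hat{N}\setminus\{b\}$; (iii) $\hat{P}\leftarrow(\hat{P}\setminus\{(a,b)\})\cup\{(a,a)\}$; (iv) $M\leftarrow M\setminus\{b\}$; (3) return $(\hat{V},\hat{N},\hat{P})$. -}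

module Defs where

open import Data.Nat using (ℕ)
import Data.Nat.Properties as ℕP
open import Data.Sum using (_⊎_; inj₁; inj₂)
import Data.Sum.Properties as SumP
open import Data.Product using (_×_; _,_; ∃; ∃-syntax)
import Data.Product.Properties as ProdP
open import Data.List using (List; _∷_; []; filter)
open import Data.List.Membership.Propositional using (_∈_)
open import Relation.Binary.PropositionalEquality using (_≡_; _≢_)
open import Relation.Binary.Definitions using (DecidableEquality)
open import Relation.Nullary using (¬_; ¬?)
open import Function.Bundles using (_⇔_)

Var  : Set
Var  = ℕ
Node : Set
Node = ℕ

-- Source of an edge: a variable (inj₁) or a node (inj₂).
-- An edge is a pair (source , target node), so P ⊆ (V × N) ∪ (N × N).
Source : Set
Source = Var ⊎ Node

Edge : Set
Edge = Source × Node

_≟E_ : DecidableEquality Edge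
_≟E_ = ProdP.≡-dec (SumP.≡-dec ℕP._≟_ ℕP._≟_) ℕP._≟_

-- Finite sets are represented by lists (membership = set membership).
-- Set difference X ∖ {x}: remove every copy of x.
removeE : Edge → List Edge → List Edge
removeE e = filter (λ e' → ¬? (e' ≟E e))

removeN : Node → List Node → List Node
removeN n = filter (λ m → ¬? (m ℕP.≟ n))

record Component : Set where
  constructor component
  field
    V̂ : List Var
    N̂ : List Node
    P̂ : List Edge

open Component public

WellFormed : Component → Set
WellFormed C =
  ∀ {s n} → (s , n) ∈ P̂ C →
    n ∈ N̂ C × ((∃[ v ] (s ≡ inj₁ v × v ∈ V̂ C)) ⊎ (∃[ m ] (s ≡ inj₂ m × m ∈ N̂ C)))

-- |P_in({n})| > 1 : two distinct edges (x,n), (y,n) with x,y ∈ N̂ ∖ {n}.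
InDegGt1 : List Node → List Edge → Node → Set
InDegGt1 N P n = ∃[ x ] ∃[ y ] (x ≢ y × x ∈ N × x ≢ n × y ∈ N × y ≢ n ×
                   (inj₂ x , n) ∈ P × (inj₂ y , n) ∈ P)

-- |P_out({n})| > 1 : two distinct edges (n,x), (n,y) with x,y ∈ N̂ ∖ {n}.
OutDegGt1 : List Node → List Edge → Node → Set
OutDegGt1 N P n = ∃[ x ] ∃[ y ] (x ≢ y × x ∈ N × x ≢ n × y ∈ N × y ≢ n ×
                    (inj₂ n , x) ∈ P × (inj₂ n , y) ∈ P)

Special : Component → Node → Set
Special C n = (∃[ v ] ((inj₁ v , n) ∈ P̂ C × v ∈ V̂ C))
            ⊎ InDegGt1 (N̂ C) (P̂ C) n
            ⊎ OutDegGt1 (N̂ C) (P̂ C) n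

Ordinary : Component → Node → Set
Ordinary C n = ¬ Special C n

-- Control point of algorithm Abstract-C:
--   outer      : at the test of the while-loop (2)
--   inner a b  : inside iteration of (2) with chosen a, b, at the test of loop (i)
data Control : Set where
  outer : Control
  inner : Node → Node → Control

record State : Set where
  constructor state
  field
    ctl : Control
    Vs  : List Var
    Ns  : List Node
    Ps  : List Edge
    Ms  : List Node

data _⇝_ : State → State → Set where
  -- loop (2): choose a, b ∈ M, a ≠ b, (a,b) ∈ P̂
  choose : ∀ {V N P M a b} → a ∈ M → b ∈ M → a ≢ b → (inj₂ a , b) ∈ P →
           state outer V N P M ⇝ state (inner a b) V N P M
  -- loop (i): choose (b,c) ∈ P̂ and replace it by (a,c)
  redirect : ∀ {V N P M a b c} → (inj₂ b , c) ∈ P →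
           state (inner a b) V N P M ⇝
           state (inner a b) V N ((inj₂ a , c) ∷ removeE (inj₂ b , c) P) M
  -- loop (i) exits; steps (ii), (iii), (iv)
  merge : ∀ {V N P M a b} → (∀ c → ¬ ((inj₂ b , c) ∈ P)) →
           state (inner a b) V N P M ⇝
           state outer V (removeN b N) ((inj₂ a , a) ∷ removeE (inj₂ a , b) P) (removeN b M)

_⟵_ : State → State → Set
s' ⟵ s = s ⇝ s'

-- Initial state: step (1), M = set of ordinary nodes of N̂.
IsOrdinarySet : Component → List Node → Set
IsOrdinarySet C M = ∀ n → (n ∈ M ⇔ (n ∈ N̂ C × Ordinary C n))

initial : Component → List Node → State
initial C M = state outer (V̂ C) (N̂ C) (P̂ C) M

module Submission where

-- Termination follows from a lexicographic measure. Each pass of loop (2)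
-- removes b from M, so |M| strictly decreases; within a pass, each step of
-- loop (i) replaces an edge leaving b by one leaving a ≠ b, so the number of
-- edges leaving b strictly decreases. Nothing else about the component is
-- needed.

open import Defs
open import Data.List using (List; []; _∷_; length; filter)
open import Data.List.Membership.Propositional using (_∈_)
open import Data.List.Membership.Propositional.Properties using (∈-filter⁺)
open import Data.List.Properties using (filter-accept; filter-reject; filter-notAll)
import Data.List.Relation.Unary.Any as Any
open import Data.Nat using (_<_)
open import Data.Nat.Induction using (<-wellFounded)
import Data.Nat.Properties as ℕP
open import Data.Product using (_,_; proj₁)
open import Data.Sum using (inj₂)
import Data.Sum.Properties as SumP
open import Function using (_∘_)
open import Induction.WellFounded using (Acc; acc; WfRec)
open import Level using (Level)
open import Relation.Binary.Definitions using (DecidableEquality)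
open import Relation.Binary.PropositionalEquality using (_≡_; refl; _≢_; cong)
open import Relation.Nullary using (yes; no; ¬?)
open import Relation.Unary using (Pred; Decidable)

module _ {a p q : Level} {A : Set a} {P : Pred A p} {Q : Pred A q}
         (P? : Decidable P) (Q? : Decidable Q) where

  filter-comm : ∀ xs → filter P? (filter Q? xs) ≡ filter Q? (filter P? xs)
  filter-comm [] = refl
  filter-comm (x ∷ xs) with P? x | Q? x
  ... | yes px | yes qx
    rewrite filter-accept P? {xs = filter Q? xs} px | filter-accept Q? {xs = filter P? xs} qx
    = cong (x ∷_) (filter-comm xs)
  ... | yes _ | no ¬qx
    rewrite filter-reject Q? {xs = filter P? xs} ¬qx = filter-comm xs
  ... | no ¬px | yes qx
    rewrite filter-reject P? {xs = filter Q? xs} ¬px = filter-comm xs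
  ... | no _ | no _ = filter-comm xs

module _ {a p : Level} {A : Set a} {P : Pred A p} (P? : Decidable P)
         (_≟_ : DecidableEquality A) where

  length-filter-remove-< : ∀ {x xs} → x ∈ xs → P x →
    length (filter P? (filter (λ y → ¬? (y ≟ x)) xs)) < length (filter P? xs)
  length-filter-remove-< {x} {xs} x∈xs Px
    rewrite filter-comm P? (λ y → ¬? (y ≟ x)) xs
    = filter-notAll (λ y → ¬? (y ≟ x)) (filter P? xs)
        (Any.map (λ { refl x≢x → x≢x refl }) (∈-filter⁺ P? x∈xs Px))

_≟S_ : DecidableEquality Source
_≟S_ = SumP.≡-dec ℕP._≟_ ℕP._≟_

outEdges : Node → List Edge → List Edge
outEdges b = filter (λ e → proj₁ e ≟S inj₂ b)

outEdges-redirect-< : ∀ {a b c P} → a ≢ b → (inj₂ b , c) ∈ P →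
  length (outEdges b ((inj₂ a , c) ∷ removeE (inj₂ b , c) P)) < length (outEdges b P)
outEdges-redirect-< {a} {b} {c} {P} a≢b bc∈P
  rewrite filter-reject (λ e → proj₁ e ≟S inj₂ b) {x = (inj₂ a , c)}
            {xs = removeE (inj₂ b , c) P} (a≢b ∘ SumP.inj₂-injective)
  = length-filter-remove-< (λ e → proj₁ e ≟S inj₂ b) _≟E_ bc∈P refl

length-removeN-< : ∀ {b M} → b ∈ M → length (removeN b M) < length M
length-removeN-< b∈M = filter-notAll _ _ (Any.map (λ { refl b≢b → b≢b refl }) b∈M)

mutual
  acc-outer : ∀ {V N P M} → Acc _<_ (length M) → Acc _⟵_ (state outer V N P M)
  acc-outer (acc smaller) = acc λ { (choose {P = P} {b = b} _ b∈M a≢b _) →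
    acc-inner smaller b∈M a≢b (<-wellFounded (length (outEdges b P))) }

  acc-inner : ∀ {a b V N P M} → WfRec _<_ (Acc _<_) (length M) → b ∈ M → a ≢ b →
              Acc _<_ (length (outEdges b P)) →
              Acc _⟵_ (state (inner a b) V N P M)
  acc-inner smaller b∈M a≢b (acc fewerOut) = acc λ
    { (redirect bc∈P) → acc-inner smaller b∈M a≢b (fewerOut (outEdges-redirect-< a≢b bc∈P))
    ; (merge _) → acc-outer (smaller (length-removeN-< b∈M)) }

theorem5 : (C : Component) → WellFormed C →
           (M : List Node) → IsOrdinarySet C M →
           Acc _⟵_ (initial C M)
theorem5 C _ M _ = acc-outer (<-wellFounded (length M))
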